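{- For all positive integers $a,k,d$ with $k<d$ (and $d\ge2$), we have $r_{d,k}(a)\le (k+1)a$.
   Context: For $d\ge1$, a $d$-colored $k$-subset of $\mathbb{N}=\{1,2,\dots\}$ is a set of $k$ positive integers no two of which are congruent modulo $d$; $\binom{\mathbb{N}}{k}_d$ denotes the set of these. They are ordered in reverse lexicographic (revlex) order: $S<T$ iff the largest element of the symmetric difference $S\triangle T$ lies in $T$ (e.g. for $k=3,d=4$: $123<124<134<234<235<245<345<\cdots$). $F_{d,k}(j)$ denotes the $j$-th element of $\binom{\mathbb{N}}{k}_d$ in revlex order. For $d\ge2$ define $\phi_d:\mathbb{N}\to\mathbb{N}$ by writing $s=(d-1)i+j$ with $i\ge0$, $1\le j\le d-1$, and setting $\phi_d(s)=di+j$; for a set $S$, $\phi_d(S)=\{\phi_d(s):s\in S\}$. Then $\phi_d$ maps $\binom{\mathbb{N}}{k}_{d-1}$ into $\binom{\mathbb{N}}{k}_d$ preserving revlex order, and $r_{d,k}(a)$ is defined as the integer $b$ with $\phi_d(F_{d-1,k}(a))=F_{d,k}(b)$. -}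

module Defs where

open import Data.Nat using (ℕ; zero; suc; _+_; _*_; _∸_; _<_; _≤_; ∣_-_∣)
open import Data.Nat.Divisibility using (_∣_)
open import Data.Nat.DivMod using (_/_; _%_)
open import Data.List using (List; length; map)
open import Data.List.Membership.Propositional using (_∈_; _∉_)
open import Data.List.Relation.Unary.All using (All)
open import Data.List.Relation.Unary.Linked using (Linked)
open import Data.List.Relation.Unary.Unique.Propositional using (Unique)
open import Data.Product using (Σ; _×_; ∃-syntax)
open import Function.Bundles using (_⇔_)
open import Relation.Binary.PropositionalEquality using (_≡_)

-- A finite subset of ℕ = {1,2,...} is represented canonically by the
-- strictly increasing list of its elements (so equal sets are ≡ lists).

_≡_[mod_] : ℕ → ℕ → ℕ → Set
x ≡ y [mod d ] = d ∣ ∣ x - y ∣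

record Colored (d k : ℕ) (S : List ℕ) : Set where
  field
    increasing : Linked _<_ S
    size       : length S ≡ k
    positive   : All (λ x → 1 ≤ x) S
    noCong     : ∀ {x y} → x ∈ S → y ∈ S → x ≡ y [mod d ] → x ≡ y

-- Reverse lexicographic order: S < T iff the largest element of the
-- symmetric difference S △ T lies in T, i.e. there is m ∈ T, m ∉ S such
-- that S and T agree on all elements larger than m.
_<revlex_ : List ℕ → List ℕ → Set
S <revlex T = ∃[ m ] (m ∈ T × m ∉ S × (∀ x → m < x → (x ∈ S ⇔ x ∈ T)))

-- IsF d k j S  :  S = F_{d,k}(j), the j-th element (j ≥ 1) of the
-- d-colored k-subsets in revlex order, i.e. S is a d-colored k-subset
-- having exactly j - 1 d-colored k-subsets strictly below it
-- (witnessed by a duplicate-free list Ts of exactly those predecessors).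
record IsF (d k j : ℕ) (S : List ℕ) : Set where
  field
    pos     : 1 ≤ j
    colored : Colored d k S
    preds   : List (List ℕ)
    predsUnique   : Unique preds
    predsLength   : length preds ≡ j ∸ 1
    predsBelow    : All (λ T → Colored d k T × T <revlex S) preds
    predsComplete : ∀ T → Colored d k T → T <revlex S → T ∈ preds

-- φ_d(s) for d ≥ 2: write s = (d-1) i + j with i ≥ 0, 1 ≤ j ≤ d-1,
-- and set φ_d(s) = d i + j.  Here i = (s-1) / (d-1), j = (s-1) % (d-1) + 1.
-- (For d < 2 the value is irrelevant; we return s.)
φ : ℕ → ℕ → ℕ
φ (suc (suc e)) s = suc (suc e) * ((s ∸ 1) / suc e) + ((s ∸ 1) % suc e + 1)
φ _ s = s

φSet : ℕ → List ℕ → List ℕ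
φSet d S = map (φ d) S

-- r_{d,k}(a) = b  iff  φ_d(F_{d-1,k}(a)) = F_{d,k}(b).
IsR : ℕ → ℕ → ℕ → ℕ → Set
IsR d k a b = Σ (List ℕ) λ S → IsF (d ∸ 1) k a S × IsF d k b (φSet d S)

-- Let S = F_{d-1,k}(a), so that r_{d,k}(a) counts the d-colored k-sets T ≤ φ_d(S).
-- Each such T is encoded by a (d-1)-colored k-set U ≤ S together with an optional
-- t ∈ U, and there are at most (k + 1) a such codes.  If T contains no multiple of d,
-- then T = φ_d(U), since φ_d is an order isomorphism from ℕ onto the non-multiples
-- of d, and there is no t.  Otherwise T contains exactly one multiple M of d and, as
-- k < d, misses some nonzero residue r; exchanging M for the y ≡ r (mod d) in
-- (M - d, M) gives a revlex smaller set φ_d(U) without multiples, and y = φ_d(t).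
-- T is recovered from (U, t) by exchanging φ_d(t) back for the next multiple of d,
-- so the encoding is injective.
module Submission where

open import Defs
open import Data.Nat
  using (ℕ; zero; suc; _+_; _*_; _∸_; _≤_; _<_; z≤n; s≤s; s≤s⁻¹; NonZero; _≟_)
open import Data.Nat.Properties
open import Data.Nat.DivMod
open import Data.Nat.Divisibility using (_∣_; divides; n∣m*n; m%n≡0⇒n∣m)
open import Data.Nat.Tactic.RingSolver using (solve-∀)
open import Data.List using (List; []; _∷_; _++_; length; map; filter; upTo)
open import Data.List.Properties
  using (length-++; length-++-sucʳ; length-map; length-upTo; map-∘; map-id-local;
         filter-all; filter-accept; filter-reject)
open import Data.List.Membership.Propositional using (_∈_; _∉_; find)
open import Data.List.Membership.Propositional.Properties
  using (∈-∃++; ∈-++⁻; ∈-++⁺ˡ; ∈-++⁺ʳ; ∈-map⁺; ∈-map⁻; ∈-filter⁺; ∈-filter⁻; ∈-upTo⁻)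
open import Data.List.Membership.Propositional.Properties.WithK using (unique∧set⇒bag)
open import Data.List.Relation.Binary.BagAndSetEquality
  using (_∼[_]_; set; [_]-Equality; ∷-cong; bag-=⇒; ↭⇒∼bag; ∼bag⇒↭)
open import Data.List.Relation.Binary.Permutation.Propositional using (↭-sym; ↭⇒↭ₛ)
open import Data.List.Relation.Binary.Permutation.Propositional.Properties
  using (∈-resp-↭; ↭-length; All-resp-↭)
import Data.List.Relation.Binary.Permutation.Propositional.Properties as Permutation
import Data.List.Relation.Binary.Permutation.Setoid.Properties as PermutationSetoid
open import Data.List.Relation.Binary.Pointwise using (Pointwise-≡⇒≡)
open import Data.List.Relation.Unary.Any using (here; there; any?)
open import Data.List.Relation.Unary.All using (All; []; _∷_; lookup; all?)
import Data.List.Relation.Unary.All as All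
open import Data.List.Relation.Unary.All.Properties using (¬All⇒Any¬; ¬Any⇒All¬)
import Data.List.Relation.Unary.All.Properties as All
import Data.List.Relation.Unary.AllPairs as AllPairs
open import Data.List.Relation.Unary.Linked using (Linked; []; [-]; _∷_)
import Data.List.Relation.Unary.Linked as Linked
open import Data.List.Relation.Unary.Linked.Properties using (Linked⇒AllPairs)
open import Data.List.Relation.Unary.Sorted.TotalOrder.Properties using (↗↭↗⇒≋)
open import Data.List.Relation.Unary.Unique.Propositional using (Unique; _∷_)
import Data.List.Relation.Unary.Unique.Propositional.Properties as Unique
open import Data.List.Sort ≤-decTotalOrder using (sort; sort-↭; sort-↗)
open import Data.Maybe using (Maybe; nothing; just)
open import Data.Product using (∃-syntax; _×_; _,_; proj₁)
open import Data.Sum using (_⊎_; inj₁; inj₂)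
open import Data.Empty using (⊥-elim)
open import Function.Base using (id; case_of_)
open import Function.Bundles using (mk⇔; Equivalence)
open import Relation.Binary using (Setoid; tri<; tri≈; tri>)
open import Relation.Binary.PropositionalEquality
open import Relation.Nullary using (¬_; ¬?; yes; no)

open Equivalence using (to; from)
open Setoid ([ set ]-Equality ℕ) using () renaming (sym to ∼-sym; trans to ∼-trans)

∈-++-∷⁻ : ∀ {A : Set} {w z : A} (xs ys : List A) → w ∈ xs ++ z ∷ ys → w ≡ z ⊎ w ∈ xs ++ ys
∈-++-∷⁻ xs ys w∈ with ∈-++⁻ xs w∈
... | inj₁ w∈xs         = inj₂ (∈-++⁺ˡ w∈xs)
... | inj₂ (here w≡z)   = inj₁ w≡z
... | inj₂ (there w∈ys) = inj₂ (∈-++⁺ʳ xs w∈ys)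

module _ {A B : Set} where

  injection⇒length≤ : (R : A → B → Set) {xs : List A} {ys : List B} → Unique xs →
    (∀ {x} → x ∈ xs → ∃[ y ] y ∈ ys × R x y) →
    (∀ {x x′} y → R x y → R x′ y → x ≡ x′) → length xs ≤ length ys
  injection⇒length≤ R {[]}     _           _     _      = z≤n
  injection⇒length≤ R {x ∷ xs} (x∉xs ∷ xs!) image inject with image (here refl)
  ... | y , y∈ys , Rxy with ∈-∃++ y∈ys
  ... | ys₁ , ys₂ , refl = subst (suc (length xs) ≤_) (sym (length-++-sucʳ ys₁ y ys₂))
      (s≤s (injection⇒length≤ R xs! image′ inject))
    where
    image′ : ∀ {x′} → x′ ∈ xs → ∃[ y′ ] y′ ∈ ys₁ ++ ys₂ × R x′ y′
    image′ x′∈xs with image (there x′∈xs)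
    ... | y′ , y′∈ , Rx′y′ with ∈-++-∷⁻ ys₁ ys₂ y′∈
    ... | inj₁ refl = ⊥-elim (lookup x∉xs x′∈xs (inject y Rxy Rx′y′))
    ... | inj₂ y′∈′ = y′ , y′∈′ , Rx′y′

Linked<⇒Unique : ∀ {xs : List ℕ} → Linked _<_ xs → Unique xs
Linked<⇒Unique xs↗ = AllPairs.map <⇒≢ (Linked⇒AllPairs <-trans xs↗)

Linked≤∧Unique⇒Linked< : ∀ {xs : List ℕ} → Linked _≤_ xs → Unique xs → Linked _<_ xs
Linked≤∧Unique⇒Linked< []  _ = []
Linked≤∧Unique⇒Linked< [-] _ = [-]
Linked≤∧Unique⇒Linked< (x≤y ∷ xs↗) ((x≢y ∷ _) ∷ xs!) =
  ≤∧≢⇒< x≤y x≢y ∷ Linked≤∧Unique⇒Linked< xs↗ xs!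

strictlySorted-∼set⇒≡ : ∀ {xs ys : List ℕ} → Linked _<_ xs → Linked _<_ ys →
                        xs ∼[ set ] ys → xs ≡ ys
strictlySorted-∼set⇒≡ xs↗ ys↗ xs∼ys = Pointwise-≡⇒≡
  (↗↭↗⇒≋ ≤-totalOrder (Linked.map <⇒≤ xs↗) (Linked.map <⇒≤ ys↗)
    (↭⇒↭ₛ (∼bag⇒↭ (unique∧set⇒bag (Linked<⇒Unique xs↗) (Linked<⇒Unique ys↗) xs∼ys))))

sort-strict : ∀ {xs : List ℕ} → Unique xs → Linked _<_ (sort xs)
sort-strict {xs} xs! = Linked≤∧Unique⇒Linked< (sort-↗ xs)
  (PermutationSetoid.Unique-resp-↭ (setoid ℕ) (↭⇒↭ₛ (↭-sym (sort-↭ xs))) xs!)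

_without_ : List ℕ → ℕ → List ℕ
xs without y = filter (λ x → ¬? (x ≟ y)) xs

∈-without⁺ : ∀ {x xs} y → x ∈ xs → x ≢ y → x ∈ xs without y
∈-without⁺ y = ∈-filter⁺ (λ x → ¬? (x ≟ y))

∈-without⁻ : ∀ {x} xs y → x ∈ xs without y → x ∈ xs × x ≢ y
∈-without⁻ xs y = ∈-filter⁻ (λ x → ¬? (x ≟ y)) {xs = xs}

without-∼ : ∀ {xs ys} y → xs ∼[ set ] ys → xs without y ∼[ set ] ys without y
without-∼ {xs} {ys} y xs∼ys = mk⇔
  (λ x∈ → let x∈xs , x≢y = ∈-without⁻ xs y x∈ in ∈-without⁺ y (to xs∼ys x∈xs) x≢y)
  (λ x∈ → let x∈ys , x≢y = ∈-without⁻ ys y x∈ in ∈-without⁺ y (from xs∼ys x∈ys) x≢y)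

length-without : ∀ {xs y} → Unique xs → y ∈ xs → suc (length (xs without y)) ≡ length xs
length-without {x ∷ xs} (x∉xs ∷ _) (here refl) = cong (λ zs → suc (length zs)) (begin
  (x ∷ xs) without x ≡⟨ filter-reject (λ z → ¬? (z ≟ x)) (λ x≢x → x≢x refl) ⟩
  xs without x       ≡⟨ filter-all (λ z → ¬? (z ≟ x)) (All.map ≢-sym x∉xs) ⟩
  xs                 ∎)
  where open ≡-Reasoning
length-without {x ∷ xs} {y} (x∉xs ∷ xs!) (there y∈xs) =
  trans (cong (λ zs → suc (length zs)) (filter-accept (λ z → ¬? (z ≟ y)) (lookup x∉xs y∈xs)))
        (cong suc (length-without xs! y∈xs))

missingResidue : ∀ n .{{_ : NonZero n}} (xs : List ℕ) → length xs < n →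
  ∃[ r ] r < n × All (λ x → x % n ≢ r) xs
missingResidue n xs |xs|<n with all? (λ r → any? (λ x → x % n ≟ r) xs) (upTo n)
... | yes covered = ⊥-elim (<⇒≱ |xs|<n (subst (_≤ length xs) (length-upTo n)
      (injection⇒length≤ (λ r x → x % n ≡ r) (Unique.upTo⁺ n) (λ r∈ → find (lookup covered r∈))
        (λ _ x≡r x≡r′ → trans (sym x≡r) x≡r′))))
... | no ¬covered with find (¬All⇒Any¬ (λ r → any? (λ x → x % n ≟ r) xs) (upTo n) ¬covered)
... | r , r∈ , ¬hit = r , ∈-upTo⁻ r∈ , ¬Any⇒All¬ xs ¬hit

codes : {A : Set} → List (List A) → List (List A × Maybe A)
codes []       = []
codes (U ∷ Us) = (U , nothing) ∷ map (λ t → U , just t) U ++ codes Us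

module _ {A : Set} where

  ∈-codes-nothing : ∀ {U : List A} {Us} → U ∈ Us → (U , nothing) ∈ codes Us
  ∈-codes-nothing             (here refl) = here refl
  ∈-codes-nothing {Us = V ∷ _} (there U∈) = there (∈-++⁺ʳ (map _ V) (∈-codes-nothing U∈))

  ∈-codes-just : ∀ {U : List A} {Us t} → U ∈ Us → t ∈ U → (U , just t) ∈ codes Us
  ∈-codes-just             (here refl) t∈U = there (∈-++⁺ˡ (∈-map⁺ _ t∈U))
  ∈-codes-just {Us = V ∷ _} (there U∈) t∈U = there (∈-++⁺ʳ (map _ V) (∈-codes-just U∈ t∈U))

  length-codes : ∀ {k} {Us : List (List A)} → All (λ U → length U ≡ k) Us →
                 length (codes Us) ≡ (k + 1) * length Us
  length-codes {k} [] = sym (*-zeroʳ (k + 1))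
  length-codes {k} {U ∷ Us} (|U|≡k ∷ |Us|≡k) = begin
    suc (length (map _ U ++ codes Us))
      ≡⟨ cong suc (length-++ (map _ U)) ⟩
    suc (length (map _ U) + length (codes Us))
      ≡⟨ cong₂ (λ m n → suc (m + n)) (trans (length-map _ U) |U|≡k) (length-codes |Us|≡k) ⟩
    suc (k + (k + 1) * length Us)
      ≡⟨ arith k (length Us) ⟩
    (k + 1) * suc (length Us)
      ∎
    where
    open ≡-Reasoning
    arith : ∀ k n → suc (k + (k + 1) * n) ≡ (k + 1) * suc n
    arith = solve-∀

≡[mod]⇒%≡ : ∀ {n} x y .{{_ : NonZero n}} → x ≡ y [mod n ] → x % n ≡ y % n
≡[mod]⇒%≡ {n} x y n∣∣x-y∣ with ≤-total x y
... | inj₁ x≤y = sym (begin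
  y % n             ≡⟨ cong (_% n) (m+[n∸m]≡n x≤y) ⟨
  (x + (y ∸ x)) % n ≡⟨ %-remove-+ʳ x (subst (n ∣_) (m≤n⇒∣m-n∣≡n∸m x≤y) n∣∣x-y∣) ⟩
  x % n             ∎)
  where open ≡-Reasoning
... | inj₂ y≤x = begin
  x % n             ≡⟨ cong (_% n) (m+[n∸m]≡n y≤x) ⟨
  (y + (x ∸ y)) % n ≡⟨ %-remove-+ʳ y (subst (n ∣_) (m≤n⇒∣n-m∣≡n∸m y≤x) n∣∣x-y∣) ⟩
  y % n             ∎
  where open ≡-Reasoning

%≡⇒∣∸ : ∀ {x y n} .{{_ : NonZero n}} → x % n ≡ y % n → n ∣ y ∸ x
%≡⇒∣∸ {x} {y} {n} x%n≡y%n = divides (y / n ∸ x / n) (begin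
  y ∸ x
    ≡⟨ cong₂ _∸_ (m≡m%n+[m/n]*n y n) (m≡m%n+[m/n]*n x n) ⟩
  (y % n + (y / n) * n) ∸ (x % n + (x / n) * n)
    ≡⟨ cong (λ r → (y % n + (y / n) * n) ∸ (r + (x / n) * n)) x%n≡y%n ⟩
  (y % n + (y / n) * n) ∸ (y % n + (x / n) * n)
    ≡⟨ [m+n]∸[m+o]≡n∸o (y % n) _ _ ⟩
  (y / n) * n ∸ (x / n) * n
    ≡⟨ *-distribʳ-∸ n (y / n) (x / n) ⟨
  (y / n ∸ x / n) * n
    ∎)
  where open ≡-Reasoning

%≡⇒≡[mod] : ∀ {n} x y .{{_ : NonZero n}} → x % n ≡ y % n → x ≡ y [mod n ]
%≡⇒≡[mod] {n} x y x%n≡y%n with ≤-total x y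
... | inj₁ x≤y = subst (n ∣_) (sym (m≤n⇒∣m-n∣≡n∸m x≤y)) (%≡⇒∣∸ x%n≡y%n)
... | inj₂ y≤x = subst (n ∣_) (sym (m≤n⇒∣n-m∣≡n∸m y≤x)) (%≡⇒∣∸ (sym x%n≡y%n))

[m+kn]%n≡m : ∀ {m} k {n} .{{_ : NonZero n}} → m < n → (m + k * n) % n ≡ m
[m+kn]%n≡m {m} k {n} m<n = trans ([m+kn]%n≡m%n m k n) (m<n⇒m%n≡m m<n)

[m+kn]/n≡k : ∀ {m} k {n} .{{_ : NonZero n}} → m < n → (m + k * n) / n ≡ k
[m+kn]/n≡k {m} k {n} m<n = begin
  (m + k * n) / n   ≡⟨ +-distrib-/-∣ʳ m (n∣m*n k) ⟩
  m / n + k * n / n ≡⟨ cong₂ _+_ (m<n⇒m/n≡0 m<n) (m*n/n≡m k n) ⟩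
  k                 ∎
  where open ≡-Reasoning

nextMultiple : (n : ℕ) .{{_ : NonZero n}} → ℕ → ℕ
nextMultiple n y = suc (y / n) * n

belowMultiple : ∀ {m r n} .{{_ : NonZero n}} → 1 ≤ m → m % n ≡ 0 → r < n →
  ∃[ y ] y % n ≡ r × y < m × nextMultiple n y ≡ m
belowMultiple {m} {r} {n} 1≤m m%n≡0 r<n with m%n≡0⇒n∣m m n m%n≡0
... | divides zero    m≡0     = ⊥-elim (<⇒≢ 1≤m (sym m≡0))
... | divides (suc p) refl    = r + p * n , [m+kn]%n≡m p r<n , +-monoˡ-< (p * n) r<n ,
                                cong (λ q → suc q * n) ([m+kn]/n≡k p r<n)

-- Colored sets listed in arbitrary order

record ColoredSet (d k : ℕ) (W : List ℕ) : Set where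
  field
    unique   : Unique W
    size     : length W ≡ k
    positive : All (1 ≤_) W
    noCong   : ∀ {x y} → x ∈ W → y ∈ W → x ≡ y [mod d ] → x ≡ y

Colored⇒ColoredSet : ∀ {d k T} → Colored d k T → ColoredSet d k T
Colored⇒ColoredSet T-col = record
  { unique = Linked<⇒Unique increasing ; size = size ; positive = positive ; noCong = noCong }
  where open Colored T-col

sort-colored : ∀ {d k W} → ColoredSet d k W → Colored d k (sort W)
sort-colored {W = W} W-col = record
  { increasing = sort-strict unique
  ; size       = trans (↭-length (sort-↭ W)) size
  ; positive   = All-resp-↭ (↭-sym (sort-↭ W)) positive
  ; noCong     = λ x∈ y∈ → noCong (∈-resp-↭ (sort-↭ W) x∈) (∈-resp-↭ (sort-↭ W) y∈)
  }
  where open ColoredSet W-col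

<revlex-irrefl : ∀ {T} → ¬ (T <revlex T)
<revlex-irrefl (m , m∈T , m∉T , _) = m∉T m∈T

<revlex-trans : ∀ {S T V} → S <revlex T → T <revlex V → S <revlex V
<revlex-trans (m , m∈T , m∉S , S≈T) (m′ , m′∈V , m′∉T , T≈V) with <-cmp m m′
... | tri< m<m′ _ _ = m′ , m′∈V , (λ m′∈S → m′∉T (to (S≈T _ m<m′) m′∈S)) ,
      λ x m′<x → let S≈T′ = S≈T x (<-trans m<m′ m′<x) in
        mk⇔ (λ x∈S → to (T≈V x m′<x) (to S≈T′ x∈S))
            (λ x∈V → from S≈T′ (from (T≈V x m′<x) x∈V))
... | tri≈ _ refl _ = ⊥-elim (m′∉T m∈T)
... | tri> _ _ m′<m = m , to (T≈V m m′<m) m∈T , m∉S ,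
      λ x m<x → let T≈V′ = T≈V x (<-trans m′<m m<x) in
        mk⇔ (λ x∈S → to T≈V′ (to (S≈T x m<x) x∈S))
            (λ x∈V → from (S≈T x m<x) (from T≈V′ x∈V))

<revlex-respˡ-∼ : ∀ {S S′ T} → S ∼[ set ] S′ → S <revlex T → S′ <revlex T
<revlex-respˡ-∼ S∼S′ (m , m∈T , m∉S , S≈T) = m , m∈T , (λ m∈S′ → m∉S (from S∼S′ m∈S′)) ,
  λ x m<x → mk⇔ (λ x∈S′ → to (S≈T x m<x) (from S∼S′ x∈S′))
                (λ x∈T → to S∼S′ (from (S≈T x m<x) x∈T))

<revlex-respʳ-∼ : ∀ {S T T′} → T ∼[ set ] T′ → S <revlex T → S <revlex T′
<revlex-respʳ-∼ T∼T′ (m , m∈T , m∉S , S≈T) = m , to T∼T′ m∈T , m∉S ,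
  λ x m<x → mk⇔ (λ x∈S → to T∼T′ (to (S≈T x m<x) x∈S))
                (λ x∈T′ → from (S≈T x m<x) (from T∼T′ x∈T′))

-- Revlex only sees membership, so the reflexive closure is taken up to set equality.
_≤revlex_ : List ℕ → List ℕ → Set
S ≤revlex T = S ∼[ set ] T ⊎ S <revlex T

∼-≤revlex-trans : ∀ {S T V} → S ∼[ set ] T → T ≤revlex V → S ≤revlex V
∼-≤revlex-trans S∼T (inj₁ T∼V) = inj₁ (∼-trans S∼T T∼V)
∼-≤revlex-trans S∼T (inj₂ T<V) = inj₂ (<revlex-respˡ-∼ (∼-sym S∼T) T<V)

<-≤revlex-trans : ∀ {S T V} → S <revlex T → T ≤revlex V → S <revlex V
<-≤revlex-trans S<T (inj₁ T∼V) = <revlex-respʳ-∼ T∼V S<T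
<-≤revlex-trans S<T (inj₂ T<V) = <revlex-trans S<T T<V

module StrictlyMonotone (f : ℕ → ℕ) (f-mono : ∀ {a b} → 1 ≤ a → a < b → f a < f b) where

  injective : ∀ {a b} → 1 ≤ a → 1 ≤ b → f a ≡ f b → a ≡ b
  injective {a} {b} 1≤a 1≤b fa≡fb with <-cmp a b
  ... | tri< a<b _ _ = ⊥-elim (<-irrefl fa≡fb (f-mono 1≤a a<b))
  ... | tri≈ _ a≡b _ = a≡b
  ... | tri> _ _ b<a = ⊥-elim (<-irrefl (sym fa≡fb) (f-mono 1≤b b<a))

  ∈-map⁻-positive : ∀ {x U} → All (1 ≤_) U → 1 ≤ x → f x ∈ map f U → x ∈ U
  ∈-map⁻-positive U⁺ 1≤x fx∈fU with ∈-map⁻ f fx∈fU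
  ... | u , u∈U , fx≡fu = subst (_∈ _) (sym (injective 1≤x (lookup U⁺ u∈U) fx≡fu)) u∈U

  map-reflects-∼ : ∀ {U V} → All (1 ≤_) U → All (1 ≤_) V →
                   map f U ∼[ set ] map f V → U ∼[ set ] V
  map-reflects-∼ U⁺ V⁺ fU∼fV = mk⇔
    (λ x∈U → ∈-map⁻-positive V⁺ (lookup U⁺ x∈U) (to fU∼fV (∈-map⁺ f x∈U)))
    (λ x∈V → ∈-map⁻-positive U⁺ (lookup V⁺ x∈V) (from fU∼fV (∈-map⁺ f x∈V)))

  map-reflects-<revlex : ∀ {U V} → All (1 ≤_) U → All (1 ≤_) V →
                         map f U <revlex map f V → U <revlex V
  map-reflects-<revlex U⁺ V⁺ (m , m∈fV , m∉fU , fU≈fV) with ∈-map⁻ f m∈fV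
  ... | v , v∈V , refl = v , v∈V , (λ v∈U → m∉fU (∈-map⁺ f v∈U)) , λ x v<x →
    let 1≤x    = ≤-trans (lookup V⁺ v∈V) (<⇒≤ v<x)
        fU≈fV′ = fU≈fV (f x) (f-mono (lookup V⁺ v∈V) v<x)
    in mk⇔ (λ x∈U → ∈-map⁻-positive V⁺ 1≤x (to fU≈fV′ (∈-map⁺ f x∈U)))
           (λ x∈V → ∈-map⁻-positive U⁺ 1≤x (from fU≈fV′ (∈-map⁺ f x∈V)))

  map-reflects-≤revlex : ∀ {U V} → All (1 ≤_) U → All (1 ≤_) V →
                         map f U ≤revlex map f V → U ≤revlex V
  map-reflects-≤revlex U⁺ V⁺ (inj₁ fU∼fV) = inj₁ (map-reflects-∼ U⁺ V⁺ fU∼fV)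
  map-reflects-≤revlex U⁺ V⁺ (inj₂ fU<fV) = inj₂ (map-reflects-<revlex U⁺ V⁺ fU<fV)

-- The shift φ_d for d = e + 2

module Shift (e : ℕ) where

  d-1 d : ℕ
  d-1 = suc e
  d   = suc d-1

  φ-normal : ∀ s → φ d (suc s) ≡ suc (s % d-1) + (s / d-1) * d
  φ-normal s = arith (s / d-1) (s % d-1)
    where
    arith : ∀ q r → suc (suc e) * q + (r + 1) ≡ suc r + q * suc (suc e)
    arith = solve-∀

  φ-suc : ∀ s → φ d (suc s) ≡ suc s + s / d-1
  φ-suc s = begin
    φ d (suc s)                               ≡⟨ φ-normal s ⟩
    suc (s % d-1) + (s / d-1) * d             ≡⟨ arith (s / d-1) (s % d-1) ⟩
    suc (s % d-1 + (s / d-1) * d-1) + s / d-1 ≡⟨ cong (λ t → suc t + s / d-1) (m≡m%n+[m/n]*n s d-1) ⟨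
    suc s + s / d-1                           ∎
    where
    open ≡-Reasoning
    arith : ∀ q r → suc r + q * suc (suc e) ≡ suc (r + q * suc e) + q
    arith = solve-∀

  φ-% : ∀ s → φ d (suc s) % d ≡ suc (s % d-1)
  φ-% s = trans (cong (_% d) (φ-normal s)) ([m+kn]%n≡m (s / d-1) (s≤s (m%n<n s d-1)))

  φ-strictMono : ∀ {a b} → 1 ≤ a → a < b → φ d a < φ d b
  φ-strictMono {suc a} {suc b} _ (s≤s a<b) rewrite φ-suc a | φ-suc b =
    +-mono-<-≤ (s≤s a<b) (/-monoˡ-≤ d-1 (<⇒≤ a<b))

  open StrictlyMonotone (φ d) φ-strictMono renaming (injective to φ-injective)

  φ-cong : ∀ {u v} → 1 ≤ u → 1 ≤ v → u ≡ v [mod d-1 ] → φ d u ≡ φ d v [mod d ]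
  φ-cong {suc a} {suc b} _ _ u≡v = %≡⇒≡[mod] (φ d (suc a)) (φ d (suc b)) (begin
    φ d (suc a) % d  ≡⟨ φ-% a ⟩
    suc (a % d-1)    ≡⟨ cong suc (≡[mod]⇒%≡ a b u≡v) ⟩
    suc (b % d-1)    ≡⟨ φ-% b ⟨
    φ d (suc b) % d  ∎)
    where open ≡-Reasoning

  -- d i + j ↦ (d - 1) i + j, the inverse of φ_d on the non-multiples of d
  φ⁻¹ : ℕ → ℕ
  φ⁻¹ x = x % d + (x / d) * d-1

  φ⁻¹-positive : ∀ {x} → x % d ≢ 0 → 1 ≤ φ⁻¹ x
  φ⁻¹-positive x%d≢0 = ≤-trans (n≢0⇒n>0 x%d≢0) (m≤m+n _ _)

  φ-φ⁻¹ : ∀ {x} → x % d ≢ 0 → φ d (φ⁻¹ x) ≡ x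
  φ-φ⁻¹ {x} x%d≢0 with x % d in x%d≡1+r
  ... | zero  = ⊥-elim (x%d≢0 refl)
  ... | suc r = begin
    φ d (suc (r + q * d-1))
      ≡⟨ φ-normal (r + q * d-1) ⟩
    suc ((r + q * d-1) % d-1) + ((r + q * d-1) / d-1) * d
      ≡⟨ cong₂ (λ r′ q′ → suc r′ + q′ * d) ([m+kn]%n≡m q r<d-1) ([m+kn]/n≡k q r<d-1) ⟩
    suc r + q * d
      ≡⟨ cong (_+ q * d) x%d≡1+r ⟨
    x % d + q * d
      ≡⟨ m≡m%n+[m/n]*n x d ⟨
    x ∎
    where
    open ≡-Reasoning
    q = x / d
    r<d-1 : r < d-1
    r<d-1 = s≤s⁻¹ (subst (_< d) x%d≡1+r (m%n<n x d))

  unshift : ∀ {k W} → ColoredSet d k W → All (λ x → x % d ≢ 0) W →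
            ∃[ U ] Colored d-1 k U × φSet d U ∼[ set ] W
  unshift {k} {W} W-col W≢0 = sort U₀ , sort-colored U₀-col , φU∼W
    where
    open ColoredSet W-col
    U₀ = map φ⁻¹ W
    φU₀≡W : φSet d U₀ ≡ W
    φU₀≡W = trans (sym (map-∘ W)) (map-id-local (All.map φ-φ⁻¹ W≢0))
    U₀⁺ : All (1 ≤_) U₀
    U₀⁺ = All.map⁺ (All.map (λ {x} → φ⁻¹-positive {x}) W≢0)
    φ∈W : ∀ {u} → u ∈ U₀ → φ d u ∈ W
    φ∈W {u} u∈ = subst (φ d u ∈_) φU₀≡W (∈-map⁺ (φ d) u∈)
    U₀-col : ColoredSet d-1 k U₀
    U₀-col = record
      { unique   = Unique.map⁻ (subst Unique (sym φU₀≡W) unique)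
      ; size     = trans (length-map φ⁻¹ W) size
      ; positive = U₀⁺
      ; noCong   = λ u∈ v∈ u≡v → let 1≤u = lookup U₀⁺ u∈ ; 1≤v = lookup U₀⁺ v∈ in
          φ-injective 1≤u 1≤v (noCong (φ∈W u∈) (φ∈W v∈) (φ-cong 1≤u 1≤v u≡v))
      }
    φU∼W : φSet d (sort U₀) ∼[ set ] W
    φU∼W = subst (φSet d (sort U₀) ∼[ set ]_) φU₀≡W
      (bag-=⇒ (↭⇒∼bag (Permutation.map⁺ (φ d) (sort-↭ U₀))))

  module Exchange {k T M y} (T-col : Colored d k T) (M∈T : M ∈ T) (M%d≡0 : M % d ≡ 0)
                  (y-fresh : All (λ x → x % d ≢ y % d) T) (y%d≢0 : y % d ≢ 0) (y<M : y < M) where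

    open Colored T-col

    W : List ℕ
    W = y ∷ (T without M)

    y∉T : y ∉ T
    y∉T y∈T = lookup y-fresh y∈T refl

    ∈W⁻ : ∀ {x} → x ∈ W → x ≡ y ⊎ x ∈ T × x ≢ M
    ∈W⁻ (here x≡y)  = inj₁ x≡y
    ∈W⁻ (there x∈)  = inj₂ (∈-without⁻ T M x∈)

    ∈W⁺ : ∀ {x} → x ∈ T → x ≢ M → x ∈ W
    ∈W⁺ x∈T x≢M = there (∈-without⁺ M x∈T x≢M)

    residues-distinct : ∀ {x x′} → x ∈ W → x′ ∈ W → x % d ≡ x′ % d → x ≡ x′
    residues-distinct {x} {x′} x∈ x′∈ x≡x′ with ∈W⁻ x∈ | ∈W⁻ x′∈
    ... | inj₁ refl       | inj₁ refl        = refl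
    ... | inj₁ refl       | inj₂ (x′∈T , _)  = ⊥-elim (lookup y-fresh x′∈T (sym x≡x′))
    ... | inj₂ (x∈T , _)  | inj₁ refl        = ⊥-elim (lookup y-fresh x∈T x≡x′)
    ... | inj₂ (x∈T , _)  | inj₂ (x′∈T , _)  = noCong x∈T x′∈T (%≡⇒≡[mod] x x′ x≡x′)

    W-nonMultiple : All (λ x → x % d ≢ 0) W
    W-nonMultiple = y%d≢0 ∷ All.tabulate λ {x} x∈ x%d≡0 →
      let x∈T , x≢M = ∈-without⁻ T M x∈
      in x≢M (noCong x∈T M∈T (%≡⇒≡[mod] x M (trans x%d≡0 (sym M%d≡0))))

    W-colored : ColoredSet d k W
    W-colored = record
      { unique   = All.tabulate (λ x∈ y≡x → y∉T (subst (_∈ T) (sym y≡x) (proj₁ (∈-without⁻ T M x∈))))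
                 ∷ Unique.filter⁺ _ (Linked<⇒Unique increasing)
      ; size     = trans (length-without (Linked<⇒Unique increasing) M∈T) size
      ; positive = n≢0⇒n>0 (λ { refl → y%d≢0 refl })
                 ∷ All.tabulate (λ x∈ → lookup positive (proj₁ (∈-without⁻ T M x∈)))
      ; noCong   = λ {x} {x′} x∈ x′∈ x≡x′ → residues-distinct x∈ x′∈ (≡[mod]⇒%≡ x x′ x≡x′)
      }

    W<T : W <revlex T
    W<T = M , M∈T , M∉W , λ x M<x → mk⇔
      (λ x∈W → case ∈W⁻ x∈W of λ
         { (inj₁ refl) → ⊥-elim (<-asym y<M M<x) ; (inj₂ (x∈T , _)) → x∈T })
      (λ x∈T → ∈W⁺ x∈T (>⇒≢ M<x))
      where
      M∉W : M ∉ W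
      M∉W M∈W = case ∈W⁻ M∈W of λ
        { (inj₁ M≡y) → <-irrefl (sym M≡y) y<M ; (inj₂ (_ , M≢M)) → M≢M refl }

    exchangeBack : M ∷ (W without y) ∼[ set ] T
    exchangeBack {x} = mk⇔
      (λ { (here refl) → M∈T
         ; (there x∈)   → let x∈W , x≢y = ∈-without⁻ W y x∈ in case ∈W⁻ x∈W of λ
             { (inj₁ x≡y) → ⊥-elim (x≢y x≡y) ; (inj₂ (x∈T , _)) → x∈T } })
      (λ x∈T → case x ≟ M of λ
         { (yes refl) → here refl
         ; (no x≢M)   → there (∈-without⁺ y (∈W⁺ x∈T x≢M) (λ { refl → y∉T x∈T })) })

  decode : List ℕ × Maybe ℕ → List ℕ
  decode (U , nothing) = φSet d U
  decode (U , just t)  = nextMultiple d (φ d t) ∷ (φSet d U without φ d t)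

  Represents : List ℕ → List ℕ × Maybe ℕ → Set
  Represents T z = Linked _<_ T × T ∼[ set ] decode z

  represents-injective : ∀ {T T′} z → Represents T z → Represents T′ z → T ≡ T′
  represents-injective _ (T↗ , T∼z) (T′↗ , T′∼z) =
    strictlySorted-∼set⇒≡ T↗ T′↗ (∼-trans T∼z (∼-sym T′∼z))

  module Encoding {k S Q} (k<d : k < d) (S-col : Colored d-1 k S)
                  (Q-complete : ∀ U → Colored d-1 k U → U <revlex S → U ∈ Q) where

    lower : ∀ {W} → ColoredSet d k W → All (λ x → x % d ≢ 0) W → W ≤revlex φSet d S →
            ∃[ U ] U ∈ S ∷ Q × φSet d U ∼[ set ] W
    lower W-col W≢0 W≤φS with unshift W-col W≢0
    ... | U , U-col , φU∼W with map-reflects-≤revlex (Colored.positive U-col) (Colored.positive S-col)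
                                                    (∼-≤revlex-trans φU∼W W≤φS)
    ... | inj₁ U∼S = U , here (strictlySorted-∼set⇒≡ (Colored.increasing U-col) (Colored.increasing S-col) U∼S)
                       , φU∼W
    ... | inj₂ U<S = U , there (Q-complete U U-col U<S) , φU∼W

    encode-nonMultiples : ∀ {T} → Colored d k T → T ≤revlex φSet d S → All (λ x → x % d ≢ 0) T →
                          ∃[ z ] z ∈ codes (S ∷ Q) × Represents T z
    encode-nonMultiples T-col T≤φS T≢0 with lower (Colored⇒ColoredSet T-col) T≢0 T≤φS
    ... | U , U∈ , φU∼T =
      (U , nothing) , ∈-codes-nothing U∈ , Colored.increasing T-col , ∼-sym φU∼T

    encode-exchange : ∀ {T M y} → Colored d k T → T ≤revlex φSet d S → M ∈ T → M % d ≡ 0 →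
                      All (λ x → x % d ≢ y % d) T → y % d ≢ 0 → y < M → nextMultiple d y ≡ M →
                      ∃[ z ] z ∈ codes (S ∷ Q) × Represents T z
    encode-exchange {T} {M} {y} T-col T≤φS M∈T M%d≡0 y-fresh y%d≢0 y<M ⌈y⌉≡M =
      let U , U∈ , φU∼W  = lower W-colored W-nonMultiple (inj₂ (<-≤revlex-trans W<T T≤φS))
          t , t∈U , y≡φt = ∈-map⁻ (φ d) (from φU∼W (here refl))
      in (U , just t) , ∈-codes-just U∈ t∈U , Colored.increasing T-col ,
         subst (λ v → T ∼[ set ] nextMultiple d v ∷ (φSet d U without v)) y≡φt
           (∼-sym (∼-trans (∷-cong ⌈y⌉≡M (without-∼ y φU∼W)) exchangeBack))
      where open Exchange T-col M∈T M%d≡0 y-fresh y%d≢0 y<M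

    encode-multiple : ∀ {T M} → Colored d k T → T ≤revlex φSet d S → M ∈ T → M % d ≡ 0 →
                      ∃[ z ] z ∈ codes (S ∷ Q) × Represents T z
    encode-multiple {T} {M} T-col T≤φS M∈T M%d≡0 =
      let r , r<d , r-missing    = missingResidue d T (subst (_< d) (sym (Colored.size T-col)) k<d)
          y , y%d≡r , y<M , ⌈y⌉≡M = belowMultiple (lookup (Colored.positive T-col) M∈T) M%d≡0 r<d
          y-fresh = subst (λ ρ → All (λ x → x % d ≢ ρ) T) (sym y%d≡r) r-missing
      in encode-exchange T-col T≤φS M∈T M%d≡0 y-fresh
           (λ y%d≡0 → lookup y-fresh M∈T (trans M%d≡0 (sym y%d≡0))) y<M ⌈y⌉≡M

    encode : ∀ {T} → Colored d k T → T ≤revlex φSet d S → ∃[ z ] z ∈ codes (S ∷ Q) × Represents T z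
    encode {T} T-col T≤φS with any? (λ x → x % d ≟ 0) T
    ... | no  no-multiple = encode-nonMultiples T-col T≤φS (¬Any⇒All¬ T no-multiple)
    ... | yes multiple    =
      let M , M∈T , M%d≡0 = find multiple in encode-multiple T-col T≤φS M∈T M%d≡0

length-rank : ∀ {d k j T} (F : IsF d k j T) → length (T ∷ IsF.preds F) ≡ j
length-rank F = trans (cong suc (IsF.predsLength F)) (trans (+-comm 1 _) (m∸n+n≡m (IsF.pos F)))

rank-unique : ∀ {d k j T} (F : IsF d k j T) → Unique (T ∷ IsF.preds F)
rank-unique {T = T} F =
  All.map (λ (_ , V<T) T≡V → <revlex-irrefl (subst (_<revlex T) (sym T≡V) V<T)) (IsF.predsBelow F)
  ∷ IsF.predsUnique F

proposition3p3 : (a k d b : ℕ) → 1 ≤ a → 1 ≤ k → k < d → 2 ≤ d →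
    IsR d k a b → b ≤ (k + 1) * a
proposition3p3 a k (suc zero)    b _ _ _   (s≤s ()) _
proposition3p3 a k (suc (suc e)) b _ _ k<d _ (S , S-rank , φS-rank) = begin
  b                        ≡⟨ length-rank φS-rank ⟨
  length (φSet d S ∷ P)    ≤⟨ injection⇒length≤ Represents (rank-unique φS-rank) encode′ represents-injective ⟩
  length (codes (S ∷ Q))   ≡⟨ length-codes sizes ⟩
  (k + 1) * length (S ∷ Q) ≡⟨ cong ((k + 1) *_) (length-rank S-rank) ⟩
  (k + 1) * a              ∎
  where
  open ≤-Reasoning
  open Shift e
  Q = IsF.preds S-rank
  P = IsF.preds φS-rank
  open Encoding k<d (IsF.colored S-rank) (IsF.predsComplete S-rank)

  encode′ : ∀ {T} → T ∈ φSet d S ∷ P → ∃[ z ] z ∈ codes (S ∷ Q) × Represents T z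
  encode′ (here refl) = encode (IsF.colored φS-rank) (inj₁ (mk⇔ id id))
  encode′ (there T∈P) =
    let T-col , T<φS = lookup (IsF.predsBelow φS-rank) T∈P in encode T-col (inj₂ T<φS)

  sizes : All (λ U → length U ≡ k) (S ∷ Q)
  sizes = Colored.size (IsF.colored S-rank)
        ∷ All.map (λ (U-col , _) → Colored.size U-col) (IsF.predsBelow S-rank)
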